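{- Let $f:\{0,1\}^n\to\{0,1\}^n$ be a Boolean network and let $I$ be a feedback vertex set of its interaction graph. If $f_v$ is monotone for every $v\notin I$, then for all fixed points $x,y$ of $f$: $x\le y$ iff $x_I\le y_I$. Consequently, the set of fixed points of $f$ is order-isomorphic to $\{x_I: x \text{ a fixed point of } f\}$.
   Context: The interaction graph of $f$ is the digraph on $[n]$ with arc $uv$ (loops allowed) iff $f_v$ depends on $x_u$. A feedback vertex set is a set of vertices meeting every directed cycle. $f_v$ is monotone if $x\le y\Rightarrow f_v(x)\le f_v(y)$. $x_I$ denotes the restriction of $x$ to the coordinates in $I$; order is componentwise. -}

module Defs where

open import Data.Nat using (ℕ)
open import Data.Bool using (Bool; not) renaming (_≤_ to _≤ᵇ_)
open import Data.Fin using (Fin)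
open import Data.Fin.Subset using (Subset; _∈_)
open import Data.Vec using (Vec; lookup; _[_]%=_)
open import Data.List using (List; []; _∷_; _++_; [_])
open import Data.List.Relation.Unary.Unique.Propositional using (Unique)
open import Data.List.Relation.Unary.Any using (Any)
open import Data.Product using (Σ; ∃; _×_; proj₁)
open import Data.Unit using (⊤)
open import Relation.Binary.PropositionalEquality using (_≡_; _≢_)
open import Function.Bundles using (_⇔_)

State : ℕ → Set
State n = Vec Bool n

BN : ℕ → Set
BN n = State n → State n

_≤ₛ_ : ∀ {n} → State n → State n → Set
x ≤ₛ y = ∀ v → lookup x v ≤ᵇ lookup y v

flipAt : ∀ {n} → Fin n → State n → State n
flipAt u x = x [ u ]%= not

-- Interaction graph: arc u → v iff f_v depends on x_u
Arc : ∀ {n} → BN n → Fin n → Fin n → Set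
Arc f u v = ∃ λ x → lookup (f x) v ≢ lookup (f (flipAt u x)) v

Chain : ∀ {n} → BN n → List (Fin n) → Set
Chain f [] = ⊤
Chain f (u ∷ []) = ⊤
Chain f (u ∷ v ∷ vs) = Arc f u v × Chain f (v ∷ vs)

-- directed cycle v₀ → v₁ → … → v_{k-1} → v₀ (k ≥ 1, distinct vertices; loops allowed)
IsCycle : ∀ {n} → BN n → List (Fin n) → Set
IsCycle f [] = Data.Empty.⊥ where import Data.Empty
IsCycle f (v ∷ vs) = Unique (v ∷ vs) × Chain f (v ∷ vs ++ [ v ])

FeedbackVertexSet : ∀ {n} → BN n → Subset n → Set
FeedbackVertexSet f I = ∀ vs → IsCycle f vs → Any (_∈ I) vs

MonotoneAt : ∀ {n} → BN n → Fin n → Set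
MonotoneAt f v = ∀ x y → x ≤ₛ y → lookup (f x) v ≤ᵇ lookup (f y) v

FixedPoint : ∀ {n} → BN n → State n → Set
FixedPoint f x = f x ≡ x

Restriction : ∀ {n} → Subset n → Set
Restriction {n} I = (v : Fin n) → v ∈ I → Bool

restrict : ∀ {n} (I : Subset n) → State n → Restriction I
restrict I x v _ = lookup x v

_≤ᴵ_ : ∀ {n} {I : Subset n} → Restriction I → Restriction I → Set
r ≤ᴵ s = ∀ v p → r v p ≤ᵇ s v p

_≈ᴵ_ : ∀ {n} {I : Subset n} → Restriction I → Restriction I → Set
r ≈ᴵ s = ∀ v p → r v p ≡ s v p

Fix : ∀ {n} → BN n → Set
Fix {n} f = Σ (State n) (FixedPoint f)

FixProj : ∀ {n} → BN n → Subset n → Set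
FixProj {n} f I = Σ (Restriction I) λ r → Σ (Fix f) λ p → restrict I (proj₁ p) ≈ᴵ r

-- order isomorphism Fix f ≅ FixProj f I (equality on FixProj is pointwise;
-- on Fix it is equality of the configurations)
OrderIsomorphic : ∀ {n} (f : BN n) (I : Subset n) → Set
OrderIsomorphic f I =
  Σ (Fix f → FixProj f I) λ φ →
    (∀ p q → (proj₁ p ≤ₛ proj₁ q) ⇔ (_≤ᴵ_ {I = I} (proj₁ (φ p)) (proj₁ (φ q))))
  × (∀ p q → _≈ᴵ_ {I = I} (proj₁ (φ p)) (proj₁ (φ q)) → proj₁ p ≡ proj₁ q)
  × (∀ (r : FixProj f I) → ∃ λ p → _≈ᴵ_ {I = I} (proj₁ (φ p)) (proj₁ r))

-- Let x, y be fixed points with x_I ≤ y_I, and let D be the set of coordinates u with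
-- x_u = 1 and y_u = 0. D avoids I, so every v ∈ D has a monotone local function. Since
-- f_v(x) = 1 and f_v(x ∧ y) ≤ f_v(y) = 0, f_v must depend on some coordinate u where x and
-- x ∧ y differ, i.e. on some u ∈ D. Every vertex of D thus has an in-neighbour in D, so
-- walking backwards inside D eventually closes a cycle avoiding I, which is impossible.
-- Hence D = ∅, i.e. x ≤ y; the order isomorphism follows by antisymmetry.
module Submission where

open import Defs
open import Data.Nat using (ℕ; zero; suc; _+_) renaming (_≤_ to _≤ℕ_)
open import Data.Nat.Properties using (+-suc; +-identityʳ; 1+n≰n)
open import Data.Fin using (Fin; zero; suc; toℕ; _≟_)
open import Data.Fin.Subset using (Subset; _∉_)
open import Data.Fin.Properties using (injective⇒≤)
open import Data.Bool using (true; false; _∧_; b≤b) renaming (_≤_ to _≤ᵇ_)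
open import Data.Bool.Properties using (¬-not; ≤-antisym; ≤-reflexive; ≤-minimum)
  renaming (_≟_ to _≟ᵇ_)
open import Data.Vec using (lookup; zipWith)
open import Data.Vec.Properties using (lookup∘updateAt; lookup∘updateAt′; lookup-zipWith)
open import Data.Vec.Relation.Binary.Pointwise.Extensional using (ext; Pointwise-≡⇒≡)
open import Data.List using (List; []; _∷_; _++_; [_]; length; take; allFin)
import Data.List as List
open import Data.List.Relation.Unary.Any using (here; there; index)
open import Data.List.Relation.Unary.Any.Properties using (¬Any[])
open import Data.List.Relation.Unary.All using (All; []; _∷_; lookupAny)
open import Data.List.Relation.Unary.All.Properties using (take⁺; ¬Any⇒All¬)
import Data.List.Relation.Unary.All as All
open import Data.List.Relation.Unary.AllPairs using ([]; _∷_)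
open import Data.List.Relation.Unary.Unique.Propositional using (Unique)
import Data.List.Relation.Unary.Unique.Propositional.Properties as Unique
open import Data.List.Membership.Propositional using () renaming (_∈_ to _∈ₗ_)
open import Data.List.Membership.Propositional.Properties using (∈-lookup; ∈-allFin)
import Data.List.Membership.DecPropositional as DecMembership
open import Data.Product as Product using (∃; _×_; _,_; proj₁; proj₂)
open import Data.Unit using (tt)
open import Data.Empty using (⊥-elim)
open import Relation.Nullary using (¬_; yes; no)
open import Relation.Nullary.Decidable using (decidable-stable)
open import Relation.Binary.PropositionalEquality using (_≡_; _≢_; refl; sym; trans; cong; subst; subst₂)
open import Function using (_∘_)
open import Function.Bundles using (_⇔_; mk⇔; Equivalence)

∧-≤ʳ : ∀ a b → a ∧ b ≤ᵇ b
∧-≤ʳ false b = ≤-minimum b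
∧-≤ʳ true  b = b≤b

∧-≢ˡ : ∀ a b → a ≢ a ∧ b → a ≡ true × b ≡ false
∧-≢ˡ false b     a≢a∧b = ⊥-elim (a≢a∧b refl)
∧-≢ˡ true  false _     = refl , refl
∧-≢ˡ true  true  a≢a∧b = ⊥-elim (a≢a∧b refl)

lookup-injective : ∀ {A : Set} {xs : List A} → Unique xs →
  ∀ i j → List.lookup xs i ≡ List.lookup xs j → i ≡ j
lookup-injective (_  ∷ _)   zero    zero    _ = refl
lookup-injective (x∉ ∷ _)   zero    (suc j) e = ⊥-elim (All.lookup x∉ (∈-lookup j) e)
lookup-injective (x∉ ∷ _)   (suc i) zero    e = ⊥-elim (All.lookup x∉ (∈-lookup i) (sym e))
lookup-injective (_  ∷ xs!) (suc i) (suc j) e = cong suc (lookup-injective xs! i j e)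

Unique⇒length≤ : ∀ {n} {xs : List (Fin n)} → Unique xs → length xs ≤ℕ n
Unique⇒length≤ xs! = injective⇒≤ (lookup-injective xs! _ _)

module _ {n : ℕ} where

  Differ : State n → State n → Fin n → Set
  Differ x z u = lookup x u ≢ lookup z u

  Exceeds : State n → State n → Fin n → Set
  Exceeds x y u = lookup x u ≡ true × lookup y u ≡ false

  lookup-ext : {x z : State n} → (∀ u → lookup x u ≡ lookup z u) → x ≡ z
  lookup-ext agree = Pointwise-≡⇒≡ (ext agree)

  ≤ₛ-antisym : {x y : State n} → x ≤ₛ y → y ≤ₛ x → x ≡ y
  ≤ₛ-antisym x≤y y≤x = lookup-ext λ u → ≤-antisym (x≤y u) (y≤x u)

  no-exceeds⇒≤ₛ : {x y : State n} → (∀ u → ¬ Exceeds x y u) → x ≤ₛ y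
  no-exceeds⇒≤ₛ {x} {y} none u with lookup x u in xu | lookup y u in yu
  ... | false | _     = ≤-minimum _
  ... | true  | true  = b≤b
  ... | true  | false = ⊥-elim (none u (xu , yu))

  flipAt-Differ : ∀ x z d u → Differ x z d → Differ (flipAt d x) z u → u ≢ d × Differ x z u
  flipAt-Differ x z d u x≢z x′≢z with u ≟ d
  ... | yes refl = ⊥-elim (x′≢z (trans (lookup∘updateAt d x) (sym (¬-not (x≢z ∘ sym)))))
  ... | no u≢d   = u≢d , x′≢z ∘ trans (lookup∘updateAt′ u d u≢d x)

module _ {n : ℕ} (f : BN n) (v : Fin n) where

  -- Flip the coordinates of ds one at a time to move from x to z; the first flip changing
  -- f_v is an arc into v.
  Differ-within⇒Arc : ∀ (ds : List (Fin n)) x z → (∀ u → Differ x z u → u ∈ₗ ds) →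
    lookup (f x) v ≢ lookup (f z) v → ∃ λ u → Arc f u v × Differ x z u
  Differ-within⇒Arc [] x z cover fx≢fz = ⊥-elim (fx≢fz (cong (λ s → lookup (f s) v) (lookup-ext agree)))
    where
    agree : ∀ u → lookup x u ≡ lookup z u
    agree u = decidable-stable (lookup x u ≟ᵇ lookup z u) (¬Any[] ∘ cover u)
  Differ-within⇒Arc (d ∷ ds) x z cover fx≢fz with lookup x d ≟ᵇ lookup z d
  ... | yes x≡z = Differ-within⇒Arc ds x z cover′ fx≢fz
    where
    cover′ : ∀ u → Differ x z u → u ∈ₗ ds
    cover′ u x≢z with cover u x≢z
    ... | here refl = ⊥-elim (x≢z x≡z)
    ... | there u∈  = u∈
  ... | no x≢z with lookup (f x) v ≟ᵇ lookup (f (flipAt d x)) v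
  ... | no changed = d , (x , changed) , x≢z
  ... | yes same   = Product.map₂ (λ {u} → Product.map₂ (proj₂ ∘ flipAt-Differ x z d u x≢z))
                       (Differ-within⇒Arc ds (flipAt d x) z cover′ (fx≢fz ∘ trans same))
    where
    cover′ : ∀ u → Differ (flipAt d x) z u → u ∈ₗ ds
    cover′ u x′≢z with flipAt-Differ x z d u x≢z x′≢z
    ... | u≢d , x≢z′ with cover u x≢z′
    ...   | here u≡d = ⊥-elim (u≢d u≡d)
    ...   | there u∈ = u∈

  Differ⇒Arc : ∀ x z → lookup (f x) v ≢ lookup (f z) v → ∃ λ u → Arc f u v × Differ x z u
  Differ⇒Arc x z = Differ-within⇒Arc (allFin n) x z (λ u _ → ∈-allFin u)

  monotone-drop⇒Arc : MonotoneAt f v → ∀ x y → lookup (f x) v ≡ true → lookup (f y) v ≡ false →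
    ∃ λ u → Arc f u v × Exceeds x y u
  monotone-drop⇒Arc mono x y fx fy =
    Product.map₂ (Product.map₂ exceeds) (Differ⇒Arc x x∧y fx≢fx∧y)
    where
    x∧y : State n
    x∧y = zipWith _∧_ x y
    x∧y≤y : x∧y ≤ₛ y
    x∧y≤y u rewrite lookup-zipWith _∧_ u x y = ∧-≤ʳ (lookup x u) (lookup y u)
    fx∧y : lookup (f x∧y) v ≡ false
    fx∧y = ≤-antisym (subst (lookup (f x∧y) v ≤ᵇ_) fy (mono x∧y y x∧y≤y)) (≤-minimum _)
    fx≢fx∧y : lookup (f x) v ≢ lookup (f x∧y) v
    fx≢fx∧y e with trans (sym fx) (trans e fx∧y)
    ... | ()
    exceeds : ∀ {u} → Differ x x∧y u → Exceeds x y u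
    exceeds {u} x≢x∧y = ∧-≢ˡ (lookup x u) (lookup y u)
                          (x≢x∧y ∘ (λ e → trans e (sym (lookup-zipWith _∧_ u x y))))

module _ {n : ℕ} (f : BN n) where

  PredecessorClosed : (Fin n → Set) → Set
  PredecessorClosed P = ∀ v → P v → ∃ λ u → Arc f u v × P u

  Chain-close : ∀ {x xs u w} (u∈ : u ∈ₗ x ∷ xs) → Chain f (x ∷ xs) → Arc f u w →
    Chain f (x ∷ take (toℕ (index u∈)) xs ++ [ w ])
  Chain-close             (here refl) _            u→w = u→w , tt
  Chain-close {xs = _ ∷ _} (there u∈) (x→y , chain) u→w = x→y , Chain-close u∈ chain u→w

  closing-Arc⇒cycle : ∀ {P : Fin n → Set} {x xs u} → u ∈ₗ x ∷ xs → Arc f u x →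
    Unique (x ∷ xs) → Chain f (x ∷ xs) → All P (x ∷ xs) → ∃ λ vs → IsCycle f vs × All P vs
  closing-Arc⇒cycle {x = x} {xs} u∈ u→x xs! chain all =
    x ∷ take k xs , (Unique.take⁺ (suc k) xs! , Chain-close u∈ chain u→x) , take⁺ (suc k) all
    where k = toℕ (index u∈)

  PredecessorClosed⇒cycle : ∀ {P} → PredecessorClosed P → ∀ v → P v →
    ∃ λ vs → IsCycle f vs × All P vs
  PredecessorClosed⇒cycle {P} closed v pv = walk n v [] (+-identityʳ n) ([] ∷ []) tt (pv ∷ [])
    where
    open DecMembership (_≟_ {n}) using (_∈?_)
    -- x ∷ xs is a simple walk grown backwards; by pigeonhole it can grow at most fuel more times.
    walk : ∀ fuel x xs → fuel + length xs ≡ n → Unique (x ∷ xs) → Chain f (x ∷ xs) → All P (x ∷ xs) →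
      ∃ λ vs → IsCycle f vs × All P vs
    walk zero x xs len xs! _ _ = ⊥-elim (1+n≰n (subst (λ m → suc m ≤ℕ n) len (Unique⇒length≤ xs!)))
    walk (suc fuel) x xs len xs! chain all@(px ∷ _) with closed x px
    ... | u , u→x , pu with u ∈? x ∷ xs
    ...   | yes u∈ = closing-Arc⇒cycle u∈ u→x xs! chain all
    ...   | no  u∉ = walk fuel u (x ∷ xs) (trans (+-suc fuel _) len)
                       (¬Any⇒All¬ _ u∉ ∷ xs!) (u→x , chain) (pu ∷ all)

  PredecessorClosed-outside-FVS⇒empty : ∀ {I P} → FeedbackVertexSet f I → (∀ u → P u → u ∉ I) →
    PredecessorClosed P → ∀ v → ¬ P v
  PredecessorClosed-outside-FVS⇒empty fvs outside closed v pv
    with PredecessorClosed⇒cycle closed v pv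
  ... | vs , cycle , all with lookupAny all (fvs vs cycle)
  ...   | pu , u∈I = outside _ pu u∈I

module _ {n : ℕ} (f : BN n) (I : Subset n) where

  RestrictionReflectsOrder : Set
  RestrictionReflectsOrder = (x y : State n) → FixedPoint f x → FixedPoint f y →
    (x ≤ₛ y) ⇔ (restrict I x ≤ᴵ restrict I y)

  FVS-restriction-reflects-order : FeedbackVertexSet f I → (∀ v → v ∉ I → MonotoneAt f v) →
    RestrictionReflectsOrder
  FVS-restriction-reflects-order fvs mono x y fx fy = mk⇔ (λ x≤y v _ → x≤y v) from
    where
    from : restrict I x ≤ᴵ restrict I y → x ≤ₛ y
    from x≤y = no-exceeds⇒≤ₛ {x = x} {y = y} (PredecessorClosed-outside-FVS⇒empty f fvs outside closed)
      where
      outside : ∀ u → Exceeds x y u → u ∉ I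
      outside u (xu , yu) u∈I with subst₂ _≤ᵇ_ xu yu (x≤y u u∈I)
      ... | ()
      closed : PredecessorClosed f (Exceeds x y)
      closed v e@(xv , yv) = monotone-drop⇒Arc f v (mono v (outside v e)) x y
        (trans (cong (λ s → lookup s v) fx) xv) (trans (cong (λ s → lookup s v) fy) yv)

  RestrictionReflectsOrder⇒OrderIsomorphic : RestrictionReflectsOrder → OrderIsomorphic f I
  RestrictionReflectsOrder⇒OrderIsomorphic order =
    φ , (λ p q → order _ _ (proj₂ p) (proj₂ q)) , injective , λ (r , p , e) → p , e
    where
    φ : Fix f → FixProj f I
    φ (x , fx) = restrict I x , (x , fx) , λ _ _ → refl
    injective : ∀ p q → _≈ᴵ_ {I = I} (proj₁ (φ p)) (proj₁ (φ q)) → proj₁ p ≡ proj₁ q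
    injective (x , fx) (y , fy) e = ≤ₛ-antisym
      (Equivalence.from (order x y fx fy) λ v p → ≤-reflexive (e v p))
      (Equivalence.from (order y x fy fx) λ v p → ≤-reflexive (sym (e v p)))

lemma2 : ∀ (n : ℕ) (f : BN n) (I : Subset n) →
    FeedbackVertexSet f I →
    (∀ (v : Fin n) → v ∉ I → MonotoneAt f v) →
    ((x y : State n) → FixedPoint f x → FixedPoint f y →
      (x ≤ₛ y) ⇔ (restrict I x ≤ᴵ restrict I y))
    × OrderIsomorphic f I
lemma2 n f I fvs mono = order , RestrictionReflectsOrder⇒OrderIsomorphic f I order
  where
  order : RestrictionReflectsOrder f I
  order = FVS-restriction-reflects-order f I fvs mono
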